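{- Let $n$ be a positive integer and let $A_k(x)=\sum_{j=0}^{k}\binom{k}{j}^2\binom{k+j}{j}^2x^j$ for $k\ge 0$. Then, as polynomials in $x$, $$\frac{1}{n}\sum_{k=0}^{n-1}(-1)^k(2k+1)A_k(x)=(-1)^{n-1}\sum_{m=0}^{n-1}\binom{2m}{m}x^m\sum_{k=0}^{m}\binom{m}{k}\binom{m+k}{k}\binom{n-1}{m+k}\binom{n+m+k}{m+k}.$$ -}

module Defs where

open import Data.Nat using (ℕ; zero; suc; _+_; _*_; _^_; _<ᵇ_)
open import Data.Nat.Combinatorics using (_C_)
open import Data.Integer using (ℤ; +_; -_)
open import Data.Rational using (ℚ; 0ℚ; 1/_) renaming (_+_ to _+ℚ_; _*_ to _*ℚ_)
import Data.Rational as ℚ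
open import Data.Bool using (if_then_else_)

-- A polynomial in x with rational coefficients, represented by its
-- coefficient sequence: (p j) is the coefficient of x^j.
Poly : Set
Poly = ℕ → ℚ

sumBelow : ℕ → (ℕ → ℚ) → ℚ
sumBelow zero    f = 0ℚ
sumBelow (suc n) f = sumBelow n f +ℚ f n

ℤ→ℚ : ℤ → ℚ
ℤ→ℚ z = ℚ._/_ z 1

ℕ→ℚ : ℕ → ℚ
ℕ→ℚ m = ℤ→ℚ (+ m)

sgn : ℕ → ℚ
sgn zero    = ℚ.1ℚ
sgn (suc k) = ℚ.- (sgn k)

_⊕_ : Poly → Poly → Poly
(p ⊕ q) j = p j +ℚ q j

_·_ : ℚ → Poly → Poly
(c · p) j = c *ℚ p j

ΣP : ℕ → (ℕ → Poly) → Poly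
ΣP n P j = sumBelow n (λ k → P k j)

mono : ℚ → ℕ → Poly
mono c m j = if (j Data.Nat.<ᵇ m) then 0ℚ else (if (m Data.Nat.<ᵇ j) then 0ℚ else c)

A : ℕ → Poly
A k = ΣP (suc k) (λ j → mono (ℕ→ℚ (((k C j) ^ 2) * (((k + j) C j) ^ 2))) j)

-- Put D k j = C(k,j) C(k+j,j), so that A_k(x) = Σ_j (D k j)² x^j. The square is linearised by
--   (D k j)² = C(2j,j) Σ_{i ≤ j} D j i · D k (j+i),
-- which follows from Vandermonde's convolution and the subset-of-a-subset rule
-- C(n,i+j) C(i+j,i) = C(n,i) C(n-i,j). Against the weights (-1)^k (2k+1) every D k s telescopes:
-- with R n s = C(n,s) C(n+1+s,s) one has (2n+3) D (n+1) s = (n+1) R n s + (n+2) R (n+1) s, hence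
--   Σ_{k<n} (-1)^k (2k+1) D k s = (-1)^(n-1) n R (n-1) s.
-- Exchanging the sums over k and i then produces the coefficient of x^j on the right-hand side.
module Submission where

open import Algebra.Bundles using (CommutativeSemiring; CommutativeRing; CommutativeMonoid)
open import Data.Nat.Base as ℕ using (ℕ; zero; suc; _≤_; _<_; _∸_)
import Data.Nat.Properties as ℕ
open import Function using (_∘_)
import Relation.Binary.PropositionalEquality as ≡

module Summation {c ℓ} (R : CommutativeSemiring c ℓ) where

  open CommutativeSemiring R hiding (zero)
  open import Algebra.Properties.CommutativeSemigroup +-commutativeSemigroup using (interchange)
  open import Algebra.Properties.CommutativeSemigroup *-commutativeSemigroup using (x∙yz≈y∙xz)
  open import Relation.Binary.Reasoning.Setoid setoid

  -- Stated for any ∑ with the defining recursion, so that it covers both ∑ below and sumBelow.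
  module Properties
    (∑ : ℕ → (ℕ → Carrier) → Carrier)
    (∑-zero : ∀ f → ∑ zero f ≈ 0#)
    (∑-suc : ∀ n f → ∑ (suc n) f ≈ ∑ n f + f n)
    where

    ∑-cong : ∀ n {f g} → (∀ {i} → i < n → f i ≈ g i) → ∑ n f ≈ ∑ n g
    ∑-cong zero    {f} {g} f≈g = trans (∑-zero f) (sym (∑-zero g))
    ∑-cong (suc n) {f} {g} f≈g = begin
      ∑ (suc n) f  ≈⟨ ∑-suc n f ⟩
      ∑ n f + f n  ≈⟨ +-cong (∑-cong n (f≈g ∘ ℕ.m<n⇒m<1+n)) (f≈g ℕ.≤-refl) ⟩
      ∑ n g + g n  ≈⟨ ∑-suc n g ⟨
      ∑ (suc n) g  ∎

    ∑-vanishing : ∀ n {f} → (∀ {i} → i < n → f i ≈ 0#) → ∑ n f ≈ 0#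
    ∑-vanishing zero    {f} f≈0 = ∑-zero f
    ∑-vanishing (suc n) {f} f≈0 = begin
      ∑ (suc n) f  ≈⟨ ∑-suc n f ⟩
      ∑ n f + f n  ≈⟨ +-cong (∑-vanishing n (f≈0 ∘ ℕ.m<n⇒m<1+n)) (f≈0 ℕ.≤-refl) ⟩
      0# + 0#      ≈⟨ +-identityˡ 0# ⟩
      0#           ∎

    ∑-distrib-+ : ∀ n f g → ∑ n (λ i → f i + g i) ≈ ∑ n f + ∑ n g
    ∑-distrib-+ zero    f g = trans (∑-zero _) (sym (trans (+-cong (∑-zero f) (∑-zero g)) (+-identityˡ 0#)))
    ∑-distrib-+ (suc n) f g = begin
      ∑ (suc n) (λ i → f i + g i)         ≈⟨ ∑-suc n _ ⟩
      ∑ n (λ i → f i + g i) + (f n + g n) ≈⟨ +-congʳ (∑-distrib-+ n f g) ⟩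
      (∑ n f + ∑ n g) + (f n + g n)       ≈⟨ interchange _ _ _ _ ⟩
      (∑ n f + f n) + (∑ n g + g n)       ≈⟨ +-cong (∑-suc n f) (∑-suc n g) ⟨
      ∑ (suc n) f + ∑ (suc n) g           ∎

    *-distribˡ-∑ : ∀ n x f → x * ∑ n f ≈ ∑ n (λ i → x * f i)
    *-distribˡ-∑ zero    x f = trans (*-congˡ (∑-zero f)) (trans (zeroʳ x) (sym (∑-zero _)))
    *-distribˡ-∑ (suc n) x f = begin
      x * ∑ (suc n) f                ≈⟨ *-congˡ (∑-suc n f) ⟩
      x * (∑ n f + f n)              ≈⟨ distribˡ x (∑ n f) (f n) ⟩
      x * ∑ n f + x * f n            ≈⟨ +-congʳ (*-distribˡ-∑ n x f) ⟩
      ∑ n (λ i → x * f i) + x * f n  ≈⟨ ∑-suc n _ ⟨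
      ∑ (suc n) (λ i → x * f i)      ∎

    ∑-comm : ∀ m n (f : ℕ → ℕ → Carrier) → ∑ m (λ i → ∑ n (f i)) ≈ ∑ n (λ t → ∑ m (λ i → f i t))
    ∑-comm zero    n f = trans (∑-zero _) (sym (∑-vanishing n (λ _ → ∑-zero _)))
    ∑-comm (suc m) n f = begin
      ∑ (suc m) (λ i → ∑ n (f i))                ≈⟨ ∑-suc m _ ⟩
      ∑ m (λ i → ∑ n (f i)) + ∑ n (f m)          ≈⟨ +-congʳ (∑-comm m n f) ⟩
      ∑ n (λ t → ∑ m (λ i → f i t)) + ∑ n (f m)  ≈⟨ ∑-distrib-+ n _ _ ⟨
      ∑ n (λ t → ∑ m (λ i → f i t) + f m t)      ≈⟨ ∑-cong n (λ _ → sym (∑-suc m _)) ⟩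
      ∑ n (λ t → ∑ (suc m) (λ i → f i t))        ∎

    ∑-comm-* : ∀ m n (x y : ℕ → Carrier) (f : ℕ → ℕ → Carrier) →
               ∑ m (λ k → x k * ∑ n (λ i → y i * f k i)) ≈ ∑ n (λ i → y i * ∑ m (λ k → x k * f k i))
    ∑-comm-* m n x y f = begin
      ∑ m (λ k → x k * ∑ n (λ i → y i * f k i))    ≈⟨ ∑-cong m (λ {k} _ → *-distribˡ-∑ n (x k) _) ⟩
      ∑ m (λ k → ∑ n (λ i → x k * (y i * f k i)))  ≈⟨ ∑-cong m (λ {k} _ → ∑-cong n (λ {i} _ → x∙yz≈y∙xz (x k) (y i) (f k i))) ⟩
      ∑ m (λ k → ∑ n (λ i → y i * (x k * f k i)))  ≈⟨ ∑-comm m n _ ⟩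
      ∑ n (λ i → ∑ m (λ k → y i * (x k * f k i)))  ≈⟨ ∑-cong n (λ {i} _ → *-distribˡ-∑ m (y i) _) ⟨
      ∑ n (λ i → y i * ∑ m (λ k → x k * f k i))    ∎

    ∑-head : ∀ n f → ∑ (suc n) f ≈ f 0 + ∑ n (f ∘ suc)
    ∑-head zero    f = begin
      ∑ 1 f                ≈⟨ ∑-suc 0 f ⟩
      ∑ 0 f + f 0          ≈⟨ +-congʳ (∑-zero f) ⟩
      0# + f 0             ≈⟨ +-comm 0# (f 0) ⟩
      f 0 + 0#             ≈⟨ +-congˡ (∑-zero _) ⟨
      f 0 + ∑ 0 (f ∘ suc)  ∎
    ∑-head (suc n) f = begin
      ∑ (suc (suc n)) f                  ≈⟨ ∑-suc (suc n) f ⟩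
      ∑ (suc n) f + f (suc n)            ≈⟨ +-congʳ (∑-head n f) ⟩
      (f 0 + ∑ n (f ∘ suc)) + f (suc n)  ≈⟨ +-assoc _ _ _ ⟩
      f 0 + (∑ n (f ∘ suc) + f (suc n))  ≈⟨ +-congˡ (∑-suc n _) ⟨
      f 0 + ∑ (suc n) (f ∘ suc)          ∎

    ∑-split : ∀ m n f → ∑ (m ℕ.+ n) f ≈ ∑ m f + ∑ n (λ i → f (m ℕ.+ i))
    ∑-split m zero    f = begin
      ∑ (m ℕ.+ 0) f  ≡⟨ ≡.cong (λ k → ∑ k f) (ℕ.+-identityʳ m) ⟩
      ∑ m f          ≈⟨ +-identityʳ (∑ m f) ⟨
      ∑ m f + 0#     ≈⟨ +-congˡ (∑-zero _) ⟨
      ∑ m f + ∑ 0 _  ∎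
    ∑-split m (suc n) f = begin
      ∑ (m ℕ.+ suc n) f                                ≡⟨ ≡.cong (λ k → ∑ k f) (ℕ.+-suc m n) ⟩
      ∑ (suc (m ℕ.+ n)) f                              ≈⟨ ∑-suc (m ℕ.+ n) f ⟩
      ∑ (m ℕ.+ n) f + f (m ℕ.+ n)                      ≈⟨ +-congʳ (∑-split m n f) ⟩
      (∑ m f + ∑ n (λ i → f (m ℕ.+ i))) + f (m ℕ.+ n)  ≈⟨ +-assoc _ _ _ ⟩
      ∑ m f + (∑ n (λ i → f (m ℕ.+ i)) + f (m ℕ.+ n))  ≈⟨ +-congˡ (∑-suc n _) ⟨
      ∑ m f + ∑ (suc n) (λ i → f (m ℕ.+ i))            ∎

    ∑-extend : ∀ {m n} f → m ≤ n → (∀ {i} → m ≤ i → f i ≈ 0#) → ∑ n f ≈ ∑ m f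
    ∑-extend {m} {n} f m≤n f≈0 = begin
      ∑ n f                                  ≡⟨ ≡.cong (λ k → ∑ k f) (ℕ.m+[n∸m]≡n m≤n) ⟨
      ∑ (m ℕ.+ (n ∸ m)) f                    ≈⟨ ∑-split m (n ∸ m) f ⟩
      ∑ m f + ∑ (n ∸ m) (λ i → f (m ℕ.+ i))  ≈⟨ +-congˡ (∑-vanishing (n ∸ m) (λ {i} _ → f≈0 (ℕ.m≤m+n m i))) ⟩
      ∑ m f + 0#                             ≈⟨ +-identityʳ _ ⟩
      ∑ m f                                  ∎

open import Data.Nat using (ℕ; suc; _+_; _*_; NonZero; _!; _^_; s≤s)
open import Data.Nat.Properties using (_!≢0; _!*_!≢0)
open import Data.Nat.DivMod using (m/n*n≡m)
open import Data.Nat.Combinatorics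
  using (_C_; nCk≡n!/k![n-k]!; k>n⇒nCk≡0; nCk≡nC[n∸k]; k![n∸k]!∣n!; nCk+nC[k+1]≡[n+1]C[k+1])
open import Data.Nat.Tactic.RingSolver using (solve-∀)
open import Data.Integer using (+_)
import Data.Integer as ℤ
import Data.Integer.Properties as ℤ
open import Data.Rational using (ℚ; _/_)
open import Data.Rational as ℚ using (0ℚ; 1ℚ; toℚᵘ) renaming (_+_ to _+ℚ_; _*_ to _*ℚ_)
import Data.Rational.Properties as ℚ
open import Data.Rational.Unnormalised as ℚᵘ using (mkℚᵘ; *≡*) renaming (_+_ to _+ᵘ_; _*_ to _*ᵘ_)
import Data.Rational.Unnormalised.Properties as ℚᵘ
open import Data.Rational.Solver using (module +-*-Solver)
open import Data.Bool using (true; false)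
open import Data.Empty using (⊥-elim)
open import Data.Sum using (inj₁; inj₂)
open import Relation.Nullary.Reflects using (ofʸ; ofⁿ)
open import Algebra.Properties.CommutativeSemigroup ℕ.+-commutativeSemigroup
  using () renaming (x∙yz≈y∙xz to x+[y+z]≡y+[x+z])
open import Algebra.Properties.CommutativeSemigroup ℕ.*-commutativeSemigroup
  using () renaming (x∙yz≈y∙xz to x*[y*z]≡y*[x*z])
open import Algebra.Properties.CommutativeSemigroup (CommutativeMonoid.commutativeSemigroup ℚ.*-1-commutativeMonoid)
  using () renaming (x∙yz≈y∙xz to x*ℚ[y*ℚz]≡y*ℚ[x*ℚz])
open ≡ using (_≡_; _≢_; refl; cong; cong₂; sym; trans; subst)
open import Defs

toℚᵘ-ℕ→ℚ : ∀ m → toℚᵘ (ℕ→ℚ m) ℚᵘ.≃ mkℚᵘ (+ m) 0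
toℚᵘ-ℕ→ℚ m = ℚ.toℚᵘ-fromℚᵘ (mkℚᵘ (+ m) 0)

ℕ→ℚ-+ : ∀ a b → ℕ→ℚ (a + b) ≡ ℕ→ℚ a +ℚ ℕ→ℚ b
ℕ→ℚ-+ a b = ℚ.toℚᵘ-injective (begin
  toℚᵘ (ℕ→ℚ (a + b))            ≈⟨ toℚᵘ-ℕ→ℚ (a + b) ⟩
  mkℚᵘ (+ (a + b)) 0             ≈⟨ *≡* (cong (ℤ._* + 1) +[a+b]≡+a*1++b*1) ⟩
  mkℚᵘ (+ a) 0 +ᵘ mkℚᵘ (+ b) 0   ≈⟨ ℚᵘ.+-cong (toℚᵘ-ℕ→ℚ a) (toℚᵘ-ℕ→ℚ b) ⟨
  toℚᵘ (ℕ→ℚ a) +ᵘ toℚᵘ (ℕ→ℚ b)   ≈⟨ ℚ.toℚᵘ-homo-+ (ℕ→ℚ a) (ℕ→ℚ b) ⟨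
  toℚᵘ (ℕ→ℚ a +ℚ ℕ→ℚ b)          ∎)
  where
  open ℚᵘ.≃-Reasoning
  +[a+b]≡+a*1++b*1 : + (a + b) ≡ + a ℤ.* + 1 ℤ.+ + b ℤ.* + 1
  +[a+b]≡+a*1++b*1 = trans (ℤ.pos-+ a b) (sym (cong₂ ℤ._+_ (ℤ.*-identityʳ (+ a)) (ℤ.*-identityʳ (+ b))))

ℕ→ℚ-* : ∀ a b → ℕ→ℚ (a * b) ≡ ℕ→ℚ a *ℚ ℕ→ℚ b
ℕ→ℚ-* a b = ℚ.toℚᵘ-injective (begin
  toℚᵘ (ℕ→ℚ (a * b))            ≈⟨ toℚᵘ-ℕ→ℚ (a * b) ⟩
  mkℚᵘ (+ (a * b)) 0             ≈⟨ *≡* (cong (ℤ._* + 1) (ℤ.pos-* a b)) ⟩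
  mkℚᵘ (+ a) 0 *ᵘ mkℚᵘ (+ b) 0   ≈⟨ ℚᵘ.*-cong (toℚᵘ-ℕ→ℚ a) (toℚᵘ-ℕ→ℚ b) ⟨
  toℚᵘ (ℕ→ℚ a) *ᵘ toℚᵘ (ℕ→ℚ b)   ≈⟨ ℚ.toℚᵘ-homo-* (ℕ→ℚ a) (ℕ→ℚ b) ⟨
  toℚᵘ (ℕ→ℚ a *ℚ ℕ→ℚ b)          ∎)
  where open ℚᵘ.≃-Reasoning

1/[1+n]*[1+n]≡1 : ∀ n → (+ 1 / suc n) *ℚ ℕ→ℚ (suc n) ≡ 1ℚ
1/[1+n]*[1+n]≡1 n = ℚ.toℚᵘ-injective (begin
  toℚᵘ ((+ 1 / suc n) *ℚ ℕ→ℚ (suc n))       ≈⟨ ℚ.toℚᵘ-homo-* (+ 1 / suc n) (ℕ→ℚ (suc n)) ⟩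
  toℚᵘ (+ 1 / suc n) *ᵘ toℚᵘ (ℕ→ℚ (suc n))  ≈⟨ ℚᵘ.*-cong (ℚ.toℚᵘ-fromℚᵘ (mkℚᵘ (+ 1) n)) (toℚᵘ-ℕ→ℚ (suc n)) ⟩
  mkℚᵘ (+ 1) n *ᵘ mkℚᵘ (+ suc n) 0          ≈⟨ *≡* (cong (λ x → + suc x) (ℕ.*-distribʳ-+ 1 n 0)) ⟩
  mkℚᵘ (+ 1) 0                              ≈⟨ ℚ.toℚᵘ-fromℚᵘ (mkℚᵘ (+ 1) 0) ⟨
  toℚᵘ 1ℚ                                   ∎)
  where open ℚᵘ.≃-Reasoning

open ≡.≡-Reasoning

∑ : ℕ → (ℕ → ℕ) → ℕ
∑ zero    f = 0
∑ (suc n) f = ∑ n f + f n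

open Summation.Properties ℕ.+-*-commutativeSemiring ∑ (λ _ → refl) (λ _ _ → refl)

nCk*[k!*[n∸k]!]≡n! : ∀ {n k} → k ≤ n → (n C k) * (k ! * (n ∸ k) !) ≡ n !
nCk*[k!*[n∸k]!]≡n! {n} {k} k≤n = begin
  (n C k) * (k ! * (n ∸ k) !)                    ≡⟨ cong (_* (k ! * (n ∸ k) !)) (nCk≡n!/k![n-k]! k≤n) ⟩
  n ! ℕ./ (k ! * (n ∸ k) !) * (k ! * (n ∸ k) !)  ≡⟨ m/n*n≡m (k![n∸k]!∣n! k≤n) ⟩
  n !                                            ∎
  where instance _ = k !* (n ∸ k) !≢0

[m+n]Cm*[m!*n!]≡[m+n]! : ∀ m n → ((m + n) C m) * (m ! * n !) ≡ (m + n) !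
[m+n]Cm*[m!*n!]≡[m+n]! m n =
  subst (λ d → ((m + n) C m) * (m ! * d !) ≡ (m + n) !) (ℕ.m+n∸m≡n m n) (nCk*[k!*[n∸k]!]≡n! (ℕ.m≤m+n m n))

*-cancelʳ-!* : ∀ {x y} a b → x * (a ! * b !) ≡ y * (a ! * b !) → x ≡ y
*-cancelʳ-!* {x} {y} a b = ℕ.*-cancelʳ-≡ x y (a ! * b !) {{a !* b !≢0}}

[1+n]C[1+k]≡nCk+nC[1+k] : ∀ n k → suc n C suc k ≡ n C k + n C suc k
[1+n]C[1+k]≡nCk+nC[1+k] n k = sym (nCk+nC[k+1]≡[n+1]C[k+1] n k)

[i+[j+e]]C[i+j]*[i+j]Ci≡[i+[j+e]]Ci*[j+e]Cj : ∀ i j e →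
  ((i + (j + e)) C (i + j)) * ((i + j) C i) ≡ ((i + (j + e)) C i) * ((j + e) C j)
[i+[j+e]]C[i+j]*[i+j]Ci≡[i+[j+e]]Ci*[j+e]Cj i j e = ℕ.*-cancelʳ-≡ _ _ (i ! * (j ! * e !)) (begin
  ((i + (j + e)) C (i + j)) * ((i + j) C i) * (i ! * (j ! * e !))
    ≡⟨ regroup ((i + (j + e)) C (i + j)) ((i + j) C i) (i !) (j !) (e !) ⟩
  ((i + (j + e)) C (i + j)) * (((i + j) C i) * (i ! * j !) * e !)
    ≡⟨ cong (λ x → ((i + (j + e)) C (i + j)) * (x * e !)) ([m+n]Cm*[m!*n!]≡[m+n]! i j) ⟩
  ((i + (j + e)) C (i + j)) * ((i + j) ! * e !)
    ≡⟨ cong (λ m → (m C (i + j)) * ((i + j) ! * e !)) (ℕ.+-assoc i j e) ⟨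
  ((i + j + e) C (i + j)) * ((i + j) ! * e !)
    ≡⟨ [m+n]Cm*[m!*n!]≡[m+n]! (i + j) e ⟩
  (i + j + e) !
    ≡⟨ cong _! (ℕ.+-assoc i j e) ⟩
  (i + (j + e)) !
    ≡⟨ [m+n]Cm*[m!*n!]≡[m+n]! i (j + e) ⟨
  ((i + (j + e)) C i) * (i ! * (j + e) !)
    ≡⟨ cong (λ x → ((i + (j + e)) C i) * (i ! * x)) ([m+n]Cm*[m!*n!]≡[m+n]! j e) ⟨
  ((i + (j + e)) C i) * (i ! * (((j + e) C j) * (j ! * e !)))
    ≡⟨ regroup′ ((i + (j + e)) C i) ((j + e) C j) (i !) (j !) (e !) ⟩
  ((i + (j + e)) C i) * ((j + e) C j) * (i ! * (j ! * e !))
    ∎)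
  where
  instance _ = ℕ.m*n≢0 (i !) (j ! * e !) {{i !≢0}} {{j !* e !≢0}}
  regroup : ∀ a b x y z → a * b * (x * (y * z)) ≡ a * (b * (x * y) * z)
  regroup = solve-∀
  regroup′ : ∀ a b x y z → a * (x * (b * (y * z))) ≡ a * b * (x * (y * z))
  regroup′ = solve-∀

nC[i+j]*[i+j]Ci≡nCi*[n∸i]Cj : ∀ n i j → (n C (i + j)) * ((i + j) C i) ≡ (n C i) * ((n ∸ i) C j)
nC[i+j]*[i+j]Ci≡nCi*[n∸i]Cj n i j with ℕ.≤-<-connex (i + j) n
... | inj₁ i+j≤n = begin
  (n C (i + j)) * ((i + j) C i)              ≡⟨ cong (λ n → (n C (i + j)) * ((i + j) C i)) n≡i+[j+e] ⟩
  ((i + (j + e)) C (i + j)) * ((i + j) C i)  ≡⟨ [i+[j+e]]C[i+j]*[i+j]Ci≡[i+[j+e]]Ci*[j+e]Cj i j e ⟩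
  ((i + (j + e)) C i) * ((j + e) C j)        ≡⟨ cong₂ (λ n m → (n C i) * (m C j)) n≡i+[j+e] n∸i≡j+e ⟨
  (n C i) * ((n ∸ i) C j)                    ∎
  where
  e = n ∸ (i + j)
  n≡i+[j+e] : n ≡ i + (j + e)
  n≡i+[j+e] = trans (sym (ℕ.m+[n∸m]≡n i+j≤n)) (ℕ.+-assoc i j e)
  n∸i≡j+e : n ∸ i ≡ j + e
  n∸i≡j+e = trans (cong (_∸ i) n≡i+[j+e]) (ℕ.m+n∸m≡n i (j + e))
... | inj₂ n<i+j with ℕ.≤-<-connex i n
...   | inj₁ i≤n = begin
  (n C (i + j)) * ((i + j) C i)  ≡⟨ cong (_* ((i + j) C i)) (k>n⇒nCk≡0 n<i+j) ⟩
  0                              ≡⟨ ℕ.*-zeroʳ (n C i) ⟨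
  (n C i) * 0                    ≡⟨ cong ((n C i) *_) (k>n⇒nCk≡0 n∸i<j) ⟨
  (n C i) * ((n ∸ i) C j)        ∎
  where
  n∸i<j : n ∸ i < j
  n∸i<j = subst (n ∸ i <_) (ℕ.m+n∸m≡n i j) (ℕ.∸-monoˡ-< n<i+j i≤n)
...   | inj₂ n<i = begin
  (n C (i + j)) * ((i + j) C i)  ≡⟨ cong (_* ((i + j) C i)) (k>n⇒nCk≡0 n<i+j) ⟩
  0                              ≡⟨ cong (_* ((n ∸ i) C j)) (k>n⇒nCk≡0 n<i) ⟨
  (n C i) * ((n ∸ i) C j)        ∎

[1+n∸k]*[1+n]Ck≡[1+n]*nCk : ∀ n k → (suc n ∸ k) * (suc n C k) ≡ suc n * (n C k)
[1+n∸k]*[1+n]Ck≡[1+n]*nCk n k with ℕ.≤-<-connex k n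
... | inj₁ k≤n = begin
  (suc n ∸ k) * (suc n C k)    ≡⟨ cong₂ (λ a m → a * (m C k)) (ℕ.+-∸-assoc 1 k≤n) (sym k+[1+d]≡1+n) ⟩
  suc d * ((k + suc d) C k)    ≡⟨ via-factorials ⟩
  suc (k + d) * ((k + d) C k)  ≡⟨ cong (λ m → suc m * (m C k)) (ℕ.m+[n∸m]≡n k≤n) ⟩
  suc n * (n C k)              ∎
  where
  d = n ∸ k
  k+[1+d]≡1+n : k + suc d ≡ suc n
  k+[1+d]≡1+n = trans (ℕ.+-suc k d) (cong suc (ℕ.m+[n∸m]≡n k≤n))
  via-factorials : suc d * ((k + suc d) C k) ≡ suc (k + d) * ((k + d) C k)
  via-factorials = *-cancelʳ-!* k d (begin
    suc d * ((k + suc d) C k) * (k ! * d !)      ≡⟨ regroup d ((k + suc d) C k) (k !) (d !) ⟩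
    ((k + suc d) C k) * (k ! * suc d !)          ≡⟨ [m+n]Cm*[m!*n!]≡[m+n]! k (suc d) ⟩
    (k + suc d) !                                ≡⟨ cong _! (ℕ.+-suc k d) ⟩
    suc (k + d) * (k + d) !                      ≡⟨ cong (suc (k + d) *_) ([m+n]Cm*[m!*n!]≡[m+n]! k d) ⟨
    suc (k + d) * (((k + d) C k) * (k ! * d !))  ≡⟨ ℕ.*-assoc (suc (k + d)) ((k + d) C k) (k ! * d !) ⟨
    suc (k + d) * ((k + d) C k) * (k ! * d !)    ∎)
    where
    regroup : ∀ s a x y → suc s * a * (x * y) ≡ a * (x * (y + s * y))
    regroup = solve-∀
... | inj₂ n<k rewrite ℕ.m≤n⇒m∸n≡0 n<k | k>n⇒nCk≡0 n<k = sym (ℕ.*-zeroʳ (suc n))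

vandermonde : ∀ p q r → (p + q) C r ≡ ∑ (suc r) (λ t → (p C t) * (q C (r ∸ t)))
vandermonde zero q r = sym (begin
  ∑ (suc r) (λ t → (0 C t) * (q C (r ∸ t)))  ≡⟨ ∑-head r _ ⟩
  1 * (q C r) + ∑ r (λ _ → 0)                ≡⟨ cong (_+_ (1 * (q C r))) (∑-vanishing r (λ _ → refl)) ⟩
  1 * (q C r) + 0                            ≡⟨ ℕ.+-identityʳ _ ⟩
  1 * (q C r)                                ≡⟨ ℕ.*-identityˡ _ ⟩
  q C r                                      ∎)
vandermonde (suc p) q zero    = refl
vandermonde (suc p) q (suc r) = begin
  suc (p + q) C suc r
    ≡⟨ [1+n]C[1+k]≡nCk+nC[1+k] (p + q) r ⟩
  (p + q) C r + (p + q) C suc r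
    ≡⟨ cong₂ _+_ (vandermonde p q r) (trans (vandermonde p q (suc r)) (∑-head (suc r) _)) ⟩
  ∑ (suc r) (λ t → (p C t) * (q C (r ∸ t))) + (1 * (q C suc r) + ∑ (suc r) (λ t → (p C suc t) * (q C (r ∸ t))))
    ≡⟨ x+[y+z]≡y+[x+z] (∑ (suc r) _) (1 * (q C suc r)) (∑ (suc r) _) ⟩
  1 * (q C suc r) + (∑ (suc r) (λ t → (p C t) * (q C (r ∸ t))) + ∑ (suc r) (λ t → (p C suc t) * (q C (r ∸ t))))
    ≡⟨ cong (_+_ (1 * (q C suc r))) (∑-distrib-+ (suc r) _ _) ⟨
  1 * (q C suc r) + ∑ (suc r) (λ t → (p C t) * (q C (r ∸ t)) + (p C suc t) * (q C (r ∸ t)))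
    ≡⟨ cong (_+_ (1 * (q C suc r))) (∑-cong (suc r) (λ {t} _ → pascal-term t)) ⟨
  1 * (q C suc r) + ∑ (suc r) (λ t → (suc p C suc t) * (q C (r ∸ t)))
    ≡⟨ ∑-head (suc r) _ ⟨
  ∑ (suc (suc r)) (λ t → (suc p C t) * (q C (suc r ∸ t)))
    ∎
  where
  pascal-term : ∀ t → (suc p C suc t) * (q C (r ∸ t)) ≡ (p C t) * (q C (r ∸ t)) + (p C suc t) * (q C (r ∸ t))
  pascal-term t = trans (cong (_* (q C (r ∸ t))) ([1+n]C[1+k]≡nCk+nC[1+k] p t))
                        (ℕ.*-distribʳ-+ (q C (r ∸ t)) (p C t) (p C suc t))

[m+n]Cn≡∑mCt*nCt : ∀ m {n a} → n ≤ a → (m + n) C n ≡ ∑ (suc a) (λ t → (m C t) * (n C t))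
[m+n]Cn≡∑mCt*nCt m {n} {a} n≤a = begin
  (m + n) C n                                ≡⟨ vandermonde m n n ⟩
  ∑ (suc n) (λ t → (m C t) * (n C (n ∸ t)))  ≡⟨ ∑-cong (suc n) (λ {t} t<1+n → cong ((m C t) *_) (sym (nCk≡nC[n∸k] (ℕ.≤-pred t<1+n)))) ⟩
  ∑ (suc n) (λ t → (m C t) * (n C t))        ≡⟨ ∑-extend _ (s≤s n≤a) nCt≡0 ⟨
  ∑ (suc a) (λ t → (m C t) * (n C t))        ∎
  where
  nCt≡0 : ∀ {t} → suc n ≤ t → (m C t) * (n C t) ≡ 0
  nCt≡0 {t} n<t = trans (cong ((m C t) *_) (k>n⇒nCk≡0 n<t)) (ℕ.*-zeroʳ (m C t))

∑mCi*iCt*NC[a∸i]≡mCt*[m∸t+N]C[a∸t] : ∀ m N {a t} → t ≤ a →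
  ∑ (suc a) (λ i → (m C i) * (i C t) * (N C (a ∸ i))) ≡ (m C t) * ((m ∸ t + N) C (a ∸ t))
∑mCi*iCt*NC[a∸i]≡mCt*[m∸t+N]C[a∸t] m N {a} {t} t≤a = begin
  ∑ (suc a) f
    ≡⟨ cong (λ n → ∑ n f) t+[1+a∸t]≡1+a ⟨
  ∑ (t + suc (a ∸ t)) f
    ≡⟨ ∑-split t (suc (a ∸ t)) f ⟩
  ∑ t f + ∑ (suc (a ∸ t)) (λ x → f (t + x))
    ≡⟨ cong (_+ ∑ (suc (a ∸ t)) (λ x → f (t + x))) (∑-vanishing t f-below-t) ⟩
  ∑ (suc (a ∸ t)) (λ x → f (t + x))
    ≡⟨ ∑-cong (suc (a ∸ t)) (λ {x} _ → f[t+x]≡) ⟩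
  ∑ (suc (a ∸ t)) (λ x → (m C t) * (((m ∸ t) C x) * (N C (a ∸ t ∸ x))))
    ≡⟨ *-distribˡ-∑ (suc (a ∸ t)) (m C t) _ ⟨
  (m C t) * ∑ (suc (a ∸ t)) (λ x → ((m ∸ t) C x) * (N C (a ∸ t ∸ x)))
    ≡⟨ cong ((m C t) *_) (vandermonde (m ∸ t) N (a ∸ t)) ⟨
  (m C t) * ((m ∸ t + N) C (a ∸ t))
    ∎
  where
  f : ℕ → ℕ
  f i = (m C i) * (i C t) * (N C (a ∸ i))
  t+[1+a∸t]≡1+a : t + suc (a ∸ t) ≡ suc a
  t+[1+a∸t]≡1+a = trans (ℕ.+-suc t (a ∸ t)) (cong suc (ℕ.m+[n∸m]≡n t≤a))
  f-below-t : ∀ {i} → i < t → f i ≡ 0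
  f-below-t {i} i<t rewrite k>n⇒nCk≡0 i<t | ℕ.*-zeroʳ (m C i) = refl
  f[t+x]≡ : ∀ {x} → f (t + x) ≡ (m C t) * (((m ∸ t) C x) * (N C (a ∸ t ∸ x)))
  f[t+x]≡ {x} = begin
    (m C (t + x)) * ((t + x) C t) * (N C (a ∸ (t + x)))
      ≡⟨ cong₂ (λ y z → y * (N C z)) (nC[i+j]*[i+j]Ci≡nCi*[n∸i]Cj m t x) (sym (ℕ.∸-+-assoc a t x)) ⟩
    (m C t) * ((m ∸ t) C x) * (N C (a ∸ t ∸ x))
      ≡⟨ ℕ.*-assoc (m C t) _ _ ⟩
    (m C t) * (((m ∸ t) C x) * (N C (a ∸ t ∸ x)))
      ∎

[m+N]Ct*mCt*[m∸t+N]C[a∸t]≡[m+N]Ca*mCt*aCt : ∀ m N {a t} → t ≤ a →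
  ((m + N) C t) * ((m C t) * ((m ∸ t + N) C (a ∸ t))) ≡ ((m + N) C a) * ((m C t) * (a C t))
[m+N]Ct*mCt*[m∸t+N]C[a∸t]≡[m+N]Ca*mCt*aCt m N {a} {t} t≤a with ℕ.≤-<-connex t m
... | inj₁ t≤m = begin
  ((m + N) C t) * ((m C t) * ((m ∸ t + N) C (a ∸ t)))
    ≡⟨ cong (λ n → ((m + N) C t) * ((m C t) * (n C (a ∸ t)))) (ℕ.+-∸-comm N t≤m) ⟨
  ((m + N) C t) * ((m C t) * ((m + N ∸ t) C (a ∸ t)))
    ≡⟨ x*[y*z]≡y*[x*z] ((m + N) C t) (m C t) _ ⟩
  (m C t) * (((m + N) C t) * ((m + N ∸ t) C (a ∸ t)))
    ≡⟨ cong ((m C t) *_) (nC[i+j]*[i+j]Ci≡nCi*[n∸i]Cj (m + N) t (a ∸ t)) ⟨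
  (m C t) * (((m + N) C (t + (a ∸ t))) * ((t + (a ∸ t)) C t))
    ≡⟨ cong (λ n → (m C t) * (((m + N) C n) * (n C t))) (ℕ.m+[n∸m]≡n t≤a) ⟩
  (m C t) * (((m + N) C a) * (a C t))
    ≡⟨ x*[y*z]≡y*[x*z] (m C t) ((m + N) C a) (a C t) ⟩
  ((m + N) C a) * ((m C t) * (a C t))
    ∎
... | inj₂ m<t rewrite k>n⇒nCk≡0 m<t = trans (ℕ.*-zeroʳ ((m + N) C t)) (sym (ℕ.*-zeroʳ ((m + N) C a)))

∑mCi*[m+N+i]Ci*NC[a∸i]≡[m+N]Ca*[m+a]Ca : ∀ m N a →
  ∑ (suc a) (λ i → (m C i) * ((m + N + i) C i) * (N C (a ∸ i))) ≡ ((m + N) C a) * ((m + a) C a)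
∑mCi*[m+N+i]Ci*NC[a∸i]≡[m+N]Ca*[m+a]Ca m N a = begin
  ∑ (suc a) (λ i → (m C i) * ((m + N + i) C i) * (N C (a ∸ i)))
    ≡⟨ ∑-cong (suc a) (λ i<1+a → expand (ℕ.≤-pred i<1+a)) ⟩
  ∑ (suc a) (λ i → ∑ (suc a) (λ t → ((m + N) C t) * g i t))
    ≡⟨ ∑-comm (suc a) (suc a) _ ⟩
  ∑ (suc a) (λ t → ∑ (suc a) (λ i → ((m + N) C t) * g i t))
    ≡⟨ ∑-cong (suc a) (λ {t} _ → *-distribˡ-∑ (suc a) ((m + N) C t) (λ i → g i t)) ⟨
  ∑ (suc a) (λ t → ((m + N) C t) * ∑ (suc a) (λ i → g i t))
    ≡⟨ ∑-cong (suc a) (λ {t} t<1+a → cong (((m + N) C t) *_) (∑mCi*iCt*NC[a∸i]≡mCt*[m∸t+N]C[a∸t] m N (ℕ.≤-pred t<1+a))) ⟩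
  ∑ (suc a) (λ t → ((m + N) C t) * ((m C t) * ((m ∸ t + N) C (a ∸ t))))
    ≡⟨ ∑-cong (suc a) (λ t<1+a → [m+N]Ct*mCt*[m∸t+N]C[a∸t]≡[m+N]Ca*mCt*aCt m N (ℕ.≤-pred t<1+a)) ⟩
  ∑ (suc a) (λ t → ((m + N) C a) * ((m C t) * (a C t)))
    ≡⟨ *-distribˡ-∑ (suc a) ((m + N) C a) _ ⟨
  ((m + N) C a) * ∑ (suc a) (λ t → (m C t) * (a C t))
    ≡⟨ cong (((m + N) C a) *_) ([m+n]Cn≡∑mCt*nCt m (ℕ.≤-refl {a})) ⟨
  ((m + N) C a) * ((m + a) C a)
    ∎
  where
  g : ℕ → ℕ → ℕ
  g i t = (m C i) * (i C t) * (N C (a ∸ i))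

  expand : ∀ {i} → i ≤ a → (m C i) * ((m + N + i) C i) * (N C (a ∸ i)) ≡ ∑ (suc a) (λ t → ((m + N) C t) * g i t)
  expand {i} i≤a = begin
    (m C i) * ((m + N + i) C i) * (N C (a ∸ i))
      ≡⟨ cong (λ x → (m C i) * x * (N C (a ∸ i))) ([m+n]Cn≡∑mCt*nCt (m + N) i≤a) ⟩
    (m C i) * ∑ (suc a) (λ t → ((m + N) C t) * (i C t)) * (N C (a ∸ i))
      ≡⟨ x*y*z≡x*z*y (m C i) _ (N C (a ∸ i)) ⟩
    (m C i) * (N C (a ∸ i)) * ∑ (suc a) (λ t → ((m + N) C t) * (i C t))
      ≡⟨ *-distribˡ-∑ (suc a) ((m C i) * (N C (a ∸ i))) _ ⟩
    ∑ (suc a) (λ t → (m C i) * (N C (a ∸ i)) * (((m + N) C t) * (i C t)))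
      ≡⟨ ∑-cong (suc a) (λ {t} _ → x*z*[u*y]≡u*[x*y*z] (m C i) (i C t) (N C (a ∸ i)) ((m + N) C t)) ⟩
    ∑ (suc a) (λ t → ((m + N) C t) * g i t)
      ∎
    where
    x*y*z≡x*z*y : ∀ x y z → x * y * z ≡ x * z * y
    x*y*z≡x*z*y = solve-∀
    x*z*[u*y]≡u*[x*y*z] : ∀ x y z u → x * z * (u * y) ≡ u * (x * y * z)
    x*z*[u*y]≡u*[x*y*z] = solve-∀

D : ℕ → ℕ → ℕ
D k j = (k C j) * ((k + j) C j)

D≡0 : ∀ {k j} → k < j → D k j ≡ 0
D≡0 {k} {j} k<j = cong (_* ((k + j) C j)) (k>n⇒nCk≡0 k<j)

[j+j]Cj*Dji*D[j+m][j+i]-regroup : ∀ j m {i} → i ≤ j →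
  ((j + j) C j) * (D j i * D (j + m) (j + i))
  ≡ D (j + m) j * ((m C i) * ((m + (j + j) + i) C i) * ((j + j) C (j ∸ i)))
[j+j]Cj*Dji*D[j+m][j+i]-regroup j m {i} i≤j = begin
  a * (b * c * (d * e))  ≡⟨ rearrange₁ a b c d e ⟩
  a * b * d * (e * c)    ≡⟨ cong (λ x → x * d * (e * c)) fg≡ab ⟨
  f * g * d * (e * c)    ≡⟨ rearrange₂ f g d (e * c) ⟩
  f * (d * g) * (e * c)  ≡⟨ cong₂ (λ x y → f * x * y) dg≡hp ec≡qr ⟩
  f * (h * p) * (q * r)  ≡⟨ cong (λ x → x * (h * p) * (q * r)) f≡s ⟩
  s * (h * p) * (q * r)  ≡⟨ rearrange₃ s h p q r ⟩
  h * r * (p * q * s)    ∎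
  where
  a = (j + j) C j
  b = j C i
  c = (j + i) C i
  d = (j + m) C (j + i)
  e = (j + m + (j + i)) C (j + i)
  f = (j + j) C (j + i)
  g = (j + i) C j
  h = (j + m) C j
  p = m C i
  q = (m + (j + j) + i) C i
  r = (j + m + j) C j
  s = (j + j) C (j ∸ i)
  fg≡ab : f * g ≡ a * b
  fg≡ab = trans (nC[i+j]*[i+j]Ci≡nCi*[n∸i]Cj (j + j) j i) (cong (λ n → a * (n C i)) (ℕ.m+n∸m≡n j j))
  dg≡hp : d * g ≡ h * p
  dg≡hp = trans (nC[i+j]*[i+j]Ci≡nCi*[n∸i]Cj (j + m) j i) (cong (λ n → h * (n C i)) (ℕ.m+n∸m≡n j m))
  ec≡qr : e * c ≡ q * r
  ec≡qr = begin
    ((j + m + (j + i)) C (j + i)) * ((j + i) C i)      ≡⟨ cong₂ (λ n x → (n C x) * (x C i)) (sym (ℕ.+-assoc (j + m) j i)) (ℕ.+-comm j i) ⟩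
    ((j + m + j + i) C (i + j)) * ((i + j) C i)        ≡⟨ nC[i+j]*[i+j]Ci≡nCi*[n∸i]Cj (j + m + j + i) i j ⟩
    ((j + m + j + i) C i) * ((j + m + j + i ∸ i) C j)  ≡⟨ cong₂ (λ n x → (n C i) * (x C j)) (j+m+j≡m+[j+j] j m i) (ℕ.m+n∸n≡m (j + m + j) i) ⟩
    q * r                                              ∎
    where
    j+m+j≡m+[j+j] : ∀ j m i → j + m + j + i ≡ m + (j + j) + i
    j+m+j≡m+[j+j] = solve-∀
  f≡s : f ≡ s
  f≡s = trans (nCk≡nC[n∸k] (ℕ.+-monoʳ-≤ j i≤j)) (cong ((j + j) C_) (ℕ.[m+n]∸[m+o]≡n∸o j j i))
  rearrange₁ : ∀ a b c d e → a * (b * c * (d * e)) ≡ a * b * d * (e * c)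
  rearrange₁ = solve-∀
  rearrange₂ : ∀ f g d x → f * g * d * x ≡ f * (d * g) * x
  rearrange₂ = solve-∀
  rearrange₃ : ∀ s h p q r → s * (h * p) * (q * r) ≡ h * r * (p * q * s)
  rearrange₃ = solve-∀

D²≡[j+j]Cj*∑Dji*Dk[j+i] : ∀ k j → D k j * D k j ≡ ((j + j) C j) * ∑ (suc j) (λ i → D j i * D k (j + i))
D²≡[j+j]Cj*∑Dji*Dk[j+i] k j with ℕ.≤-<-connex j k
... | inj₁ j≤k = subst (λ k → D k j * D k j ≡ ((j + j) C j) * ∑ (suc j) (λ i → D j i * D k (j + i)))
                       (ℕ.m+[n∸m]≡n j≤k) (sym (begin
  ((j + j) C j) * ∑ (suc j) (λ i → D j i * D (j + m) (j + i))
    ≡⟨ *-distribˡ-∑ (suc j) ((j + j) C j) _ ⟩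
  ∑ (suc j) (λ i → ((j + j) C j) * (D j i * D (j + m) (j + i)))
    ≡⟨ ∑-cong (suc j) (λ i<1+j → [j+j]Cj*Dji*D[j+m][j+i]-regroup j m (ℕ.≤-pred i<1+j)) ⟩
  ∑ (suc j) (λ i → D (j + m) j * ((m C i) * ((m + (j + j) + i) C i) * ((j + j) C (j ∸ i))))
    ≡⟨ *-distribˡ-∑ (suc j) (D (j + m) j) _ ⟨
  D (j + m) j * ∑ (suc j) (λ i → (m C i) * ((m + (j + j) + i) C i) * ((j + j) C (j ∸ i)))
    ≡⟨ cong (D (j + m) j *_) (∑mCi*[m+N+i]Ci*NC[a∸i]≡[m+N]Ca*[m+a]Ca m (j + j) j) ⟩
  D (j + m) j * (((m + (j + j)) C j) * ((m + j) C j))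
    ≡⟨ cong (D (j + m) j *_) [m+[j+j]]Cj*[m+j]Cj≡D[j+m]j ⟩
  D (j + m) j * D (j + m) j
    ∎))
  where
  m = k ∸ j
  m+[j+j]≡j+m+j : ∀ m j → m + (j + j) ≡ j + m + j
  m+[j+j]≡j+m+j = solve-∀
  [m+[j+j]]Cj*[m+j]Cj≡D[j+m]j : ((m + (j + j)) C j) * ((m + j) C j) ≡ D (j + m) j
  [m+[j+j]]Cj*[m+j]Cj≡D[j+m]j = trans (ℕ.*-comm ((m + (j + j)) C j) ((m + j) C j))
    (cong₂ (λ x y → (x C j) * (y C j)) (ℕ.+-comm m j) (m+[j+j]≡j+m+j m j))
... | inj₂ k<j = begin
  D k j * D k j                                          ≡⟨ cong (λ x → x * x) (D≡0 k<j) ⟩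
  0                                                      ≡⟨ ℕ.*-zeroʳ ((j + j) C j) ⟨
  ((j + j) C j) * 0                                      ≡⟨ cong (((j + j) C j) *_) (∑-vanishing (suc j) Dk[j+i]≡0) ⟨
  ((j + j) C j) * ∑ (suc j) (λ i → D j i * D k (j + i))  ∎
  where
  Dk[j+i]≡0 : ∀ {i} → i < suc j → D j i * D k (j + i) ≡ 0
  Dk[j+i]≡0 {i} _ = trans (cong (D j i *_) (D≡0 (ℕ.<-≤-trans k<j (ℕ.m≤m+n j i)))) (ℕ.*-zeroʳ (D j i))

R : ℕ → ℕ → ℕ
R n s = (n C s) * ((suc n + s) C s)

[3+2n]*D[1+n]s≡[1+n]*Rns+[2+n]*R[1+n]s : ∀ n s →
  (2 * suc n + 1) * D (suc n) s ≡ suc n * R n s + suc (suc n) * R (suc n) s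
[3+2n]*D[1+n]s≡[1+n]*Rns+[2+n]*R[1+n]s n s = sym (begin
  suc n * ((n C s) * X) + suc (suc n) * (P * Y)
    ≡⟨ rearrange₁ (suc n) (n C s) X (suc (suc n)) P Y ⟩
  suc n * (n C s) * X + P * (suc (suc n) * Y)
    ≡⟨ cong₂ (λ x y → x * X + P * y) ([1+n∸k]*[1+n]Ck≡[1+n]*nCk n s) [2+n]*Y≡[2+n+s]*X ⟨
  (suc n ∸ s) * P * X + P * ((suc (suc n) + s) * X)
    ≡⟨ rearrange₂ (suc n ∸ s) s n P X ⟩
  (P * (suc n ∸ s + s) + P * suc (suc n)) * X
    ≡⟨ cong (λ x → (x + P * suc (suc n)) * X) P*[1+n∸s+s]≡P*[1+n] ⟩
  (P * suc n + P * suc (suc n)) * X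
    ≡⟨ rearrange₃ n P X ⟩
  (2 * suc n + 1) * (P * X)
    ∎)
  where
  P = suc n C s
  X = (suc n + s) C s
  Y = (suc (suc n) + s) C s
  [2+n]*Y≡[2+n+s]*X : (suc (suc n) + s) * X ≡ suc (suc n) * Y
  [2+n]*Y≡[2+n+s]*X = sym (trans (cong (_* Y) (sym (ℕ.m+n∸n≡m (suc (suc n)) s)))
                                 ([1+n∸k]*[1+n]Ck≡[1+n]*nCk (suc n + s) s))
  P*[1+n∸s+s]≡P*[1+n] : P * (suc n ∸ s + s) ≡ P * suc n
  P*[1+n∸s+s]≡P*[1+n] with ℕ.≤-<-connex s (suc n)
  ... | inj₁ s≤1+n = cong (P *_) (ℕ.m∸n+n≡m s≤1+n)
  ... | inj₂ 1+n<s rewrite k>n⇒nCk≡0 1+n<s = refl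
  rearrange₁ : ∀ a b x c p y → a * (b * x) + c * (p * y) ≡ a * b * x + p * (c * y)
  rearrange₁ = solve-∀
  rearrange₂ : ∀ c s n p x → c * p * x + p * ((suc (suc n) + s) * x) ≡ (p * (c + s) + p * suc (suc n)) * x
  rearrange₂ = solve-∀
  rearrange₃ : ∀ n p x → (p * suc n + p * suc (suc n)) * x ≡ (2 * suc n + 1) * (p * x)
  rearrange₃ = solve-∀

module sumBelow =
  Summation.Properties (CommutativeRing.commutativeSemiring ℚ.+-*-commutativeRing) sumBelow (λ _ → refl) (λ _ _ → refl)

ℕ→ℚ-∑ : ∀ n f → ℕ→ℚ (∑ n f) ≡ sumBelow n (λ i → ℕ→ℚ (f i))
ℕ→ℚ-∑ zero    f = refl
ℕ→ℚ-∑ (suc n) f = trans (ℕ→ℚ-+ (∑ n f) (f n)) (cong (_+ℚ ℕ→ℚ (f n)) (ℕ→ℚ-∑ n f))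

mono-diag : ∀ c j → mono c j j ≡ c
mono-diag c j with j ℕ.<ᵇ j | ℕ.<ᵇ-reflects-< j j
... | false | _       = refl
... | true  | ofʸ j<j = ⊥-elim (ℕ.<-irrefl refl j<j)

mono-off-diag : ∀ c {m j} → m ≢ j → mono c m j ≡ 0ℚ
mono-off-diag c {m} {j} m≢j with j ℕ.<ᵇ m | m ℕ.<ᵇ j | ℕ.<ᵇ-reflects-< j m | ℕ.<ᵇ-reflects-< m j
... | true  | _     | _       | _       = refl
... | false | true  | _       | _       = refl
... | false | false | ofⁿ j≮m | ofⁿ m≮j = ⊥-elim (m≢j (ℕ.≤-antisym (ℕ.≮⇒≥ j≮m) (ℕ.≮⇒≥ m≮j)))

ΣP-mono : ∀ n (f : ℕ → ℚ) j → (n ≤ j → f j ≡ 0ℚ) → ΣP n (λ i → mono (f i) i) j ≡ f j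
ΣP-mono n f j f≡0 with ℕ.<-≤-connex j n
... | inj₂ n≤j = trans (sumBelow.∑-vanishing n (λ i<n → mono-off-diag _ (ℕ.<⇒≢ (ℕ.<-≤-trans i<n n≤j)))) (sym (f≡0 n≤j))
... | inj₁ j<n = below n j<n
  where
  below : ∀ n → j < n → ΣP n (λ i → mono (f i) i) j ≡ f j
  below (suc n) (s≤s j≤n) with ℕ.m≤n⇒m<n∨m≡n j≤n
  ... | inj₁ j<n  = trans (cong₂ _+ℚ_ (below n j<n) (mono-off-diag _ (ℕ.>⇒≢ j<n))) (ℚ.+-identityʳ (f j))
  ... | inj₂ refl = trans (cong₂ _+ℚ_ (sumBelow.∑-vanishing j (λ i<j → mono-off-diag _ (ℕ.<⇒≢ i<j))) (mono-diag _ j))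
                          (ℚ.+-identityˡ (f j))

alternating-telescope : ∀ (c F : ℕ → ℚ) → c 0 ≡ F 0 → (∀ n → c (suc n) ≡ F n +ℚ F (suc n)) →
                        ∀ n → sumBelow (suc n) (λ k → sgn k *ℚ c k) ≡ sgn n *ℚ F n
alternating-telescope c F c₀≡F₀ c≡F+F zero = trans (ℚ.+-identityˡ _) (cong (1ℚ *ℚ_) c₀≡F₀)
alternating-telescope c F c₀≡F₀ c≡F+F (suc n) = begin
  sumBelow (suc n) (λ k → sgn k *ℚ c k) +ℚ ℚ.- sgn n *ℚ c (suc n)
    ≡⟨ cong₂ (λ x y → x +ℚ ℚ.- sgn n *ℚ y) (alternating-telescope c F c₀≡F₀ c≡F+F n) (c≡F+F n) ⟩
  sgn n *ℚ F n +ℚ ℚ.- sgn n *ℚ (F n +ℚ F (suc n))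
    ≡⟨ cancel (sgn n) (F n) (F (suc n)) ⟩
  ℚ.- sgn n *ℚ F (suc n)
    ∎
  where
  open +-*-Solver
  cancel : ∀ s x y → s *ℚ x +ℚ ℚ.- s *ℚ (x +ℚ y) ≡ ℚ.- s *ℚ y
  cancel = solve 3 (λ s x y → s :* x :+ (:- s) :* (x :+ y) := (:- s) :* y) refl

∑[-1]^k[2k+1]D : ∀ n s →
  sumBelow (suc n) (λ k → (sgn k *ℚ ℕ→ℚ (2 * k + 1)) *ℚ ℕ→ℚ (D k s)) ≡ sgn n *ℚ ℕ→ℚ (suc n * R n s)
∑[-1]^k[2k+1]D n s = begin
  sumBelow (suc n) (λ k → (sgn k *ℚ ℕ→ℚ (2 * k + 1)) *ℚ ℕ→ℚ (D k s))
    ≡⟨ sumBelow.∑-cong (suc n) (λ {k} _ → trans (ℚ.*-assoc (sgn k) _ _) (cong (sgn k *ℚ_) (sym (ℕ→ℚ-* (2 * k + 1) (D k s))))) ⟩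
  sumBelow (suc n) (λ k → sgn k *ℚ ℕ→ℚ ((2 * k + 1) * D k s))
    ≡⟨ alternating-telescope _ (λ n → ℕ→ℚ (suc n * R n s)) (cong ℕ→ℚ (D0s≡R0s s)) step n ⟩
  sgn n *ℚ ℕ→ℚ (suc n * R n s)
    ∎
  where
  D0s≡R0s : ∀ s → (2 * 0 + 1) * D 0 s ≡ 1 * R 0 s
  D0s≡R0s zero    = refl
  D0s≡R0s (suc s) = refl
  step : ∀ n → ℕ→ℚ ((2 * suc n + 1) * D (suc n) s) ≡ ℕ→ℚ (suc n * R n s) +ℚ ℕ→ℚ (suc (suc n) * R (suc n) s)
  step n = trans (cong ℕ→ℚ ([3+2n]*D[1+n]s≡[1+n]*Rns+[2+n]*R[1+n]s n s)) (ℕ→ℚ-+ (suc n * R n s) _)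

∑[-1]^k[2k+1]D² : ∀ n j →
  sumBelow (suc n) (λ k → (sgn k *ℚ ℕ→ℚ (2 * k + 1)) *ℚ ℕ→ℚ (D k j * D k j))
  ≡ (sgn n *ℚ ℕ→ℚ (suc n)) *ℚ (ℕ→ℚ ((j + j) C j) *ℚ sumBelow (suc j) (λ i → ℕ→ℚ (D j i * R n (j + i))))
∑[-1]^k[2k+1]D² n j = begin
  sumBelow (suc n) (λ k → a k *ℚ ℕ→ℚ (D k j * D k j))
    ≡⟨ sumBelow.∑-cong (suc n) (λ {k} _ → cong (a k *ℚ_) (D²-in-ℚ k)) ⟩
  sumBelow (suc n) (λ k → a k *ℚ (b *ℚ sumBelow (suc j) (λ i → d i *ℚ e k i)))
    ≡⟨ sumBelow.∑-cong (suc n) (λ {k} _ → x*ℚ[y*ℚz]≡y*ℚ[x*ℚz] (a k) b _) ⟩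
  sumBelow (suc n) (λ k → b *ℚ (a k *ℚ sumBelow (suc j) (λ i → d i *ℚ e k i)))
    ≡⟨ sumBelow.*-distribˡ-∑ (suc n) b _ ⟨
  b *ℚ sumBelow (suc n) (λ k → a k *ℚ sumBelow (suc j) (λ i → d i *ℚ e k i))
    ≡⟨ cong (b *ℚ_) (sumBelow.∑-comm-* (suc n) (suc j) a d e) ⟩
  b *ℚ sumBelow (suc j) (λ i → d i *ℚ sumBelow (suc n) (λ k → a k *ℚ e k i))
    ≡⟨ cong (b *ℚ_) (sumBelow.∑-cong (suc j) (λ {i} _ → cong (d i *ℚ_) (∑[-1]^k[2k+1]D n (j + i)))) ⟩
  b *ℚ sumBelow (suc j) (λ i → d i *ℚ (sgn n *ℚ ℕ→ℚ (suc n * R n (j + i))))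
    ≡⟨ cong (b *ℚ_) (sumBelow.∑-cong (suc j) (λ {i} _ → rearrange i)) ⟩
  b *ℚ sumBelow (suc j) (λ i → (sgn n *ℚ ℕ→ℚ (suc n)) *ℚ ℕ→ℚ (D j i * R n (j + i)))
    ≡⟨ cong (b *ℚ_) (sumBelow.*-distribˡ-∑ (suc j) (sgn n *ℚ ℕ→ℚ (suc n)) _) ⟨
  b *ℚ ((sgn n *ℚ ℕ→ℚ (suc n)) *ℚ sumBelow (suc j) (λ i → ℕ→ℚ (D j i * R n (j + i))))
    ≡⟨ x*ℚ[y*ℚz]≡y*ℚ[x*ℚz] b (sgn n *ℚ ℕ→ℚ (suc n)) _ ⟩
  (sgn n *ℚ ℕ→ℚ (suc n)) *ℚ (b *ℚ sumBelow (suc j) (λ i → ℕ→ℚ (D j i * R n (j + i))))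
    ∎
  where
  a : ℕ → ℚ
  a k = sgn k *ℚ ℕ→ℚ (2 * k + 1)
  b = ℕ→ℚ ((j + j) C j)
  d : ℕ → ℚ
  d i = ℕ→ℚ (D j i)
  e : ℕ → ℕ → ℚ
  e k i = ℕ→ℚ (D k (j + i))

  D²-in-ℚ : ∀ k → ℕ→ℚ (D k j * D k j) ≡ b *ℚ sumBelow (suc j) (λ i → d i *ℚ e k i)
  D²-in-ℚ k = begin
    ℕ→ℚ (D k j * D k j)
      ≡⟨ cong ℕ→ℚ (D²≡[j+j]Cj*∑Dji*Dk[j+i] k j) ⟩
    ℕ→ℚ (((j + j) C j) * ∑ (suc j) (λ i → D j i * D k (j + i)))
      ≡⟨ ℕ→ℚ-* ((j + j) C j) _ ⟩
    b *ℚ ℕ→ℚ (∑ (suc j) (λ i → D j i * D k (j + i)))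
      ≡⟨ cong (b *ℚ_) (ℕ→ℚ-∑ (suc j) _) ⟩
    b *ℚ sumBelow (suc j) (λ i → ℕ→ℚ (D j i * D k (j + i)))
      ≡⟨ cong (b *ℚ_) (sumBelow.∑-cong (suc j) (λ {i} _ → ℕ→ℚ-* (D j i) (D k (j + i)))) ⟩
    b *ℚ sumBelow (suc j) (λ i → d i *ℚ e k i)
      ∎

  rearrange : ∀ i →
    d i *ℚ (sgn n *ℚ ℕ→ℚ (suc n * R n (j + i))) ≡ (sgn n *ℚ ℕ→ℚ (suc n)) *ℚ ℕ→ℚ (D j i * R n (j + i))
  rearrange i = begin
    d i *ℚ (sgn n *ℚ ℕ→ℚ (suc n * r))         ≡⟨ cong (λ x → d i *ℚ (sgn n *ℚ x)) (ℕ→ℚ-* (suc n) r) ⟩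
    d i *ℚ (sgn n *ℚ (ℕ→ℚ (suc n) *ℚ ℕ→ℚ r))  ≡⟨ reorder (d i) (sgn n) (ℕ→ℚ (suc n)) (ℕ→ℚ r) ⟩
    (sgn n *ℚ ℕ→ℚ (suc n)) *ℚ (d i *ℚ ℕ→ℚ r)  ≡⟨ cong ((sgn n *ℚ ℕ→ℚ (suc n)) *ℚ_) (ℕ→ℚ-* (D j i) r) ⟨
    (sgn n *ℚ ℕ→ℚ (suc n)) *ℚ ℕ→ℚ (D j i * r) ∎
    where
    r = R n (j + i)
    open +-*-Solver
    reorder : ∀ x s m y → x *ℚ (s *ℚ (m *ℚ y)) ≡ (s *ℚ m) *ℚ (x *ℚ y)
    reorder = solve 4 (λ x s m y → x :* (s :* (m :* y)) := (s :* m) :* (x :* y)) refl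

A-coefficient : ∀ k j → A k j ≡ ℕ→ℚ (D k j * D k j)
A-coefficient k j = trans (ΣP-mono (suc k) _ j vanishing) (cong ℕ→ℚ (x²*y²≡xy*xy (k C j) ((k + j) C j)))
  where
  vanishing : suc k ≤ j → ℕ→ℚ (((k C j) ^ 2) * (((k + j) C j) ^ 2)) ≡ 0ℚ
  vanishing k<j rewrite k>n⇒nCk≡0 k<j = refl
  x²*y²≡xy*xy : ∀ x y → (x * (x * 1)) * (y * (y * 1)) ≡ x * y * (x * y)
  x²*y²≡xy*xy = solve-∀

-- The coefficient of x^m on the right-hand side, without the sign (-1)^(n-1).
B : ℕ → ℕ → ℚ
B n m = ℕ→ℚ ((2 * m) C m) *ℚ
  sumBelow (suc m) (λ k → ℕ→ℚ ((m C k) * ((m + k) C k) * ((ℕ.pred n) C (m + k)) * ((n + m + k) C (m + k))))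

B-coefficient : ∀ n j → B (suc n) j ≡ ℕ→ℚ ((j + j) C j) *ℚ sumBelow (suc j) (λ i → ℕ→ℚ (D j i * R n (j + i)))
B-coefficient n j = cong₂ _*ℚ_ (cong (λ m → ℕ→ℚ ((j + m) C j)) (ℕ.+-identityʳ j))
                               (sumBelow.∑-cong (suc j) (λ {i} _ → cong ℕ→ℚ (regroup i)))
  where
  regroup : ∀ i → (j C i) * ((j + i) C i) * (n C (j + i)) * ((suc n + j + i) C (j + i)) ≡ D j i * R n (j + i)
  regroup i = trans (ℕ.*-assoc (D j i) _ _) (cong (λ m → D j i * ((n C (j + i)) * (m C (j + i)))) (ℕ.+-assoc (suc n) j i))

B-vanishing : ∀ n j → suc n ≤ j → B (suc n) j ≡ 0ℚ
B-vanishing n j n<j = begin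
  B (suc n) j
    ≡⟨ B-coefficient n j ⟩
  ℕ→ℚ ((j + j) C j) *ℚ sumBelow (suc j) (λ i → ℕ→ℚ (D j i * R n (j + i)))
    ≡⟨ cong (ℕ→ℚ ((j + j) C j) *ℚ_) (sumBelow.∑-vanishing (suc j) R≡0) ⟩
  ℕ→ℚ ((j + j) C j) *ℚ 0ℚ
    ≡⟨ ℚ.*-zeroʳ (ℕ→ℚ ((j + j) C j)) ⟩
  0ℚ
    ∎
  where
  R≡0 : ∀ {i} → i < suc j → ℕ→ℚ (D j i * R n (j + i)) ≡ 0ℚ
  R≡0 {i} _ rewrite k>n⇒nCk≡0 (ℕ.<-≤-trans n<j (ℕ.m≤m+n j i)) | ℕ.*-zeroʳ (D j i) = refl

theorem2p1 : (n : ℕ) → .{{_ : NonZero n}} → (j : ℕ) →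
    ((+ 1 / n) · ΣP n (λ k → (sgn k Data.Rational.* ℕ→ℚ (2 * k + 1)) · A k)) j
      ≡ (sgn (Data.Nat.pred n) · ΣP n (λ m → mono (ℕ→ℚ ((2 * m) C m) Data.Rational.* sumBelow (suc m) (λ k → ℕ→ℚ ((m C k) * ((m + k) C k) * ((Data.Nat.pred n) C (m + k)) * ((n + m + k) C (m + k))))) m)) j
theorem2p1 (suc n) j = begin
  (+ 1 / suc n) *ℚ sumBelow (suc n) (λ k → a k *ℚ A k j)
    ≡⟨ cong ((+ 1 / suc n) *ℚ_) (sumBelow.∑-cong (suc n) (λ {k} _ → cong (a k *ℚ_) (A-coefficient k j))) ⟩
  (+ 1 / suc n) *ℚ sumBelow (suc n) (λ k → a k *ℚ ℕ→ℚ (D k j * D k j))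
    ≡⟨ cong ((+ 1 / suc n) *ℚ_) (∑[-1]^k[2k+1]D² n j) ⟩
  (+ 1 / suc n) *ℚ ((sgn n *ℚ ℕ→ℚ (suc n)) *ℚ S)
    ≡⟨ cancel-1/[1+n] (sgn n) S ⟩
  sgn n *ℚ S
    ≡⟨ cong (sgn n *ℚ_) (trans (ΣP-mono (suc n) (B (suc n)) j (B-vanishing n j)) (B-coefficient n j)) ⟨
  sgn n *ℚ ΣP (suc n) (λ m → mono (B (suc n) m) m) j
    ∎
  where
  a : ℕ → ℚ
  a k = sgn k *ℚ ℕ→ℚ (2 * k + 1)
  S = ℕ→ℚ ((j + j) C j) *ℚ sumBelow (suc j) (λ i → ℕ→ℚ (D j i * R n (j + i)))
  cancel-1/[1+n] : ∀ s x → (+ 1 / suc n) *ℚ ((s *ℚ ℕ→ℚ (suc n)) *ℚ x) ≡ s *ℚ x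
  cancel-1/[1+n] s x = begin
    (+ 1 / suc n) *ℚ ((s *ℚ ℕ→ℚ (suc n)) *ℚ x)  ≡⟨ reorder (+ 1 / suc n) s (ℕ→ℚ (suc n)) x ⟩
    ((+ 1 / suc n) *ℚ ℕ→ℚ (suc n)) *ℚ (s *ℚ x)  ≡⟨ cong (_*ℚ (s *ℚ x)) (1/[1+n]*[1+n]≡1 n) ⟩
    1ℚ *ℚ (s *ℚ x)                              ≡⟨ ℚ.*-identityˡ _ ⟩
    s *ℚ x                                      ∎
    where
    open +-*-Solver
    reorder : ∀ p s m x → p *ℚ ((s *ℚ m) *ℚ x) ≡ (p *ℚ m) *ℚ (s *ℚ x)
    reorder = solve 4 (λ p s m x → p :* ((s :* m) :* x) := (p :* m) :* (s :* x)) refl
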